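{- Let $v>k>i\ge 0$ be integers with $v\ge 2k$, $(v,k,i)\neq(2k,k,0)$, and $k>i+1$, and let $\Delta=v-2k+2i$. For integers $x$ define $$f(x)=\min\left\{2\left\lceil\frac{k-x}{\Delta}\right\rceil,\ 2\left\lceil\frac{x-i}{\Delta}\right\rceil+1\right\},$$ and let $\mathcal{I}=\{i+1,\ldots,k\}$. Then $\max_{x\in\mathcal{I}} f(x)=\left\lceil\frac{k-i-1}{\Delta}\right\rceil+1$. -}

module Defs where

open import Data.Nat using (ℕ; zero; suc; _+_; _*_; _∸_; _⊓_)
open import Data.Nat.DivMod using (_/_)

-- Ceiling division ⌈ a / d ⌉ for d > 0, computed as ⌊ (a + d - 1) / d ⌋.
-- (Junk value 0 when d = 0; never used in that case.)
⌈_/_⌉ : ℕ → ℕ → ℕ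
⌈ a / zero ⌉ = 0
⌈ a / suc d ⌉ = (a + d) / suc d

Δ : ℕ → ℕ → ℕ → ℕ
Δ v k i = (v ∸ 2 * k) + 2 * i

-- f(x) = min { 2⌈(k-x)/Δ⌉ , 2⌈(x-i)/Δ⌉ + 1 }  (used for i < x ≤ k, so the subtractions are exact)
f : ℕ → ℕ → ℕ → ℕ → ℕ
f v k i x = (2 * ⌈ (k ∸ x) / Δ v k i ⌉) ⊓ (2 * ⌈ (x ∸ i) / Δ v k i ⌉ + 1)

-- With n = Δ > 0, put a = k − x and b = x − i − 1, so that a + b = k − i − 1 and
-- f(x) = min (2A, 2B + 1) with A = ⌈a/n⌉ and B = ⌈(b+1)/n⌉ = ⌊b/n⌋ + 1.
-- Since min (2A, 2B + 1) ≤ A + B and ⌈a/n⌉ + ⌊b/n⌋ ≤ ⌈(a+b)/n⌉, f is at most C + 1,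
-- where C = ⌈(k−i−1)/n⌉. Equality min (2A, 2B + 1) = A + B = C + 1 holds for
-- A = ⌈(C+1)/2⌉ and B = ⌊(C+1)/2⌋, which the choice b = (⌊(C+1)/2⌋ − 1)·n realises.
module Submission where

open import Defs
open import Data.Nat
open import Data.Nat.Properties
open import Data.Nat.DivMod
open import Data.Nat.Divisibility using (∣-refl)
open import Data.Product using (_×_; _,_; Σ-syntax)
open import Algebra.Properties.CommutativeSemigroup +-commutativeSemigroup using (xy∙z≈xz∙y)
open import Relation.Binary.PropositionalEquality
open import Relation.Nullary using (¬_; yes; no)

2m⊓[2n+1]≤m+n : ∀ m n → 2 * m ⊓ (2 * n + 1) ≤ m + n
2m⊓[2n+1]≤m+n m n with m ≤? n
... | yes m≤n = begin
  2 * m ⊓ (2 * n + 1) ≤⟨ m⊓n≤m (2 * m) _ ⟩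
  m + (m + 0)         ≡⟨ cong (m +_) (+-identityʳ m) ⟩
  m + m               ≤⟨ +-monoʳ-≤ m m≤n ⟩
  m + n               ∎
  where open ≤-Reasoning
... | no m≰n = begin
  2 * m ⊓ (2 * n + 1) ≤⟨ m⊓n≤n (2 * m) _ ⟩
  n + (n + 0) + 1     ≡⟨ +-comm (n + (n + 0)) 1 ⟩
  suc n + (n + 0)     ≡⟨ cong (suc n +_) (+-identityʳ n) ⟩
  suc n + n           ≤⟨ +-monoˡ-≤ n (≰⇒> m≰n) ⟩
  m + n               ∎
  where open ≤-Reasoning

2⌈n/2⌉⊓[2⌊n/2⌋+1]≡n : ∀ n → 2 * ⌈ n /2⌉ ⊓ (2 * ⌊ n /2⌋ + 1) ≡ n
2⌈n/2⌉⊓[2⌊n/2⌋+1]≡n zero = refl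
2⌈n/2⌉⊓[2⌊n/2⌋+1]≡n (suc zero) = refl
2⌈n/2⌉⊓[2⌊n/2⌋+1]≡n (suc (suc n)) = begin
  2 * suc ⌈ n /2⌉ ⊓ (2 * suc ⌊ n /2⌋ + 1)
    ≡⟨ cong₂ _⊓_ (*-suc 2 ⌈ n /2⌉) (cong (_+ 1) (*-suc 2 ⌊ n /2⌋)) ⟩
  (2 + 2 * ⌈ n /2⌉) ⊓ (2 + 2 * ⌊ n /2⌋ + 1)
    ≡⟨⟩
  2 + 2 * ⌈ n /2⌉ ⊓ (2 * ⌊ n /2⌋ + 1)
    ≡⟨ cong (2 +_) (2⌈n/2⌉⊓[2⌊n/2⌋+1]≡n n) ⟩
  2 + n ∎
  where open ≡-Reasoning

n∸⌊n/2⌋≡⌈n/2⌉ : ∀ n → n ∸ ⌊ n /2⌋ ≡ ⌈ n /2⌉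
n∸⌊n/2⌋≡⌈n/2⌉ n = begin
  n ∸ ⌊ n /2⌋                 ≡⟨ cong (_∸ ⌊ n /2⌋) (⌊n/2⌋+⌈n/2⌉≡n n) ⟨
  ⌊ n /2⌋ + ⌈ n /2⌉ ∸ ⌊ n /2⌋ ≡⟨ m+n∸m≡n ⌊ n /2⌋ ⌈ n /2⌉ ⟩
  ⌈ n /2⌉                     ∎
  where open ≡-Reasoning

m/o+n/o≤[m+n]/o : ∀ m n o .{{_ : NonZero o}} → m / o + n / o ≤ (m + n) / o
m/o+n/o≤[m+n]/o m n o = begin
  m / o + n / o           ≡⟨ m*n/n≡m (m / o + n / o) o ⟨
  (m / o + n / o) * o / o ≤⟨ /-monoˡ-≤ o (begin
    (m / o + n / o) * o     ≡⟨ *-distribʳ-+ o (m / o) (n / o) ⟩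
    m / o * o + n / o * o   ≤⟨ +-mono-≤ (m/n*n≤m m o) (m/n*n≤m n o) ⟩
    m + n                   ∎) ⟩
  (m + n) / o             ∎
  where open ≤-Reasoning

⌈1+m/n⌉≡1+m/n : ∀ m n .{{_ : NonZero n}} → ⌈ suc m / n ⌉ ≡ suc (m / n)
⌈1+m/n⌉≡1+m/n m n@(suc n-1) = begin
  (suc m + n-1) / n ≡⟨ cong (_/ n) (sym (+-suc m n-1)) ⟩
  (m + n) / n       ≡⟨ +-distrib-/-∣ʳ m (∣-refl {n}) ⟩
  m / n + n / n     ≡⟨ cong (m / n +_) (n/n≡1 n) ⟩
  m / n + 1         ≡⟨ +-comm (m / n) 1 ⟩
  suc (m / n)       ∎
  where open ≡-Reasoning

⌈m/n⌉+⌈1+o/n⌉≤⌈[m+o]/n⌉+1 : ∀ m o n .{{_ : NonZero n}} →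
  ⌈ m / n ⌉ + ⌈ suc o / n ⌉ ≤ ⌈ (m + o) / n ⌉ + 1
⌈m/n⌉+⌈1+o/n⌉≤⌈[m+o]/n⌉+1 m o n@(suc n-1) = begin
  (m + n-1) / n + ⌈ suc o / n ⌉ ≡⟨ cong ((m + n-1) / n +_) (⌈1+m/n⌉≡1+m/n o n) ⟩
  (m + n-1) / n + suc (o / n)   ≡⟨ +-suc ((m + n-1) / n) (o / n) ⟩
  suc ((m + n-1) / n + o / n)   ≤⟨ s≤s (m/o+n/o≤[m+n]/o (m + n-1) o n) ⟩
  suc ((m + n-1 + o) / n)       ≡⟨ cong (λ l → suc (l / n)) (xy∙z≈xz∙y m n-1 o) ⟩
  suc ((m + o + n-1) / n)       ≡⟨ +-comm 1 _ ⟩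
  ⌈ (m + o) / n ⌉ + 1           ∎
  where open ≤-Reasoning

m<⌈n/o⌉⇒m*o<n : ∀ {m n o} .{{_ : NonZero o}} → m < ⌈ n / o ⌉ → m * o < n
m<⌈n/o⌉⇒m*o<n {m} {n} {o@(suc o-1)} m<⌈n/o⌉ = +-cancelˡ-< o-1 (m * o) n (begin-strict
  o-1 + m * o       <⟨ ≤-refl ⟩
  suc m * o         ≤⟨ *-monoˡ-≤ o m<⌈n/o⌉ ⟩
  (n + o-1) / o * o ≤⟨ m/n*n≤m (n + o-1) o ⟩
  n + o-1           ≡⟨ +-comm n o-1 ⟩
  o-1 + n           ∎)
  where open ≤-Reasoning

⌈[m∸n*o]/o⌉≡⌈m/o⌉∸n : ∀ m n o .{{_ : NonZero o}} → n * o ≤ m →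
  ⌈ (m ∸ n * o) / o ⌉ ≡ ⌈ m / o ⌉ ∸ n
⌈[m∸n*o]/o⌉≡⌈m/o⌉∸n m n o@(suc o-1) n*o≤m = begin
  (m ∸ n * o + o-1) / o ≡⟨ cong (_/ o) (+-∸-comm o-1 n*o≤m) ⟨
  (m + o-1 ∸ n * o) / o ≡⟨ [m∸n*o]/o≡m/o∸n (m + o-1) n o ⟩
  (m + o-1) / o ∸ n     ∎
  where open ≡-Reasoning

m∸n+[n∸o]≡m∸o : ∀ {m n o} → o ≤ n → n ≤ m → (m ∸ n) + (n ∸ o) ≡ m ∸ o
m∸n+[n∸o]≡m∸o {m} {n} {o} o≤n n≤m =
  trans (sym (+-∸-assoc (m ∸ n) o≤n)) (cong (_∸ o) (m∸n+n≡m n≤m))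

0<m⇒0<⌈m/n⌉ : ∀ m n .{{_ : NonZero n}} → 0 < m → 0 < ⌈ m / n ⌉
0<m⇒0<⌈m/n⌉ m n@(suc n-1) 0<m = m≥n⇒m/n>0 (+-monoˡ-≤ n-1 0<m)

f′ : ℕ → ℕ → ℕ → ℕ
f′ n a b = 2 * ⌈ a / n ⌉ ⊓ (2 * ⌈ suc b / n ⌉ + 1)

f≡f′ : ∀ v k {i x} → i < x → f v k i x ≡ f′ (Δ v k i) (k ∸ x) (x ∸ suc i)
f≡f′ v k {i} {x} i<x =
  cong (λ l → 2 * ⌈ (k ∸ x) / Δ v k i ⌉ ⊓ (2 * ⌈ l / Δ v k i ⌉ + 1)) (+-∸-assoc 1 i<x)

f′≤⌈[a+b]/n⌉+1 : ∀ a b n .{{_ : NonZero n}} → f′ n a b ≤ ⌈ (a + b) / n ⌉ + 1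
f′≤⌈[a+b]/n⌉+1 a b n =
  ≤-trans (2m⊓[2n+1]≤m+n ⌈ a / n ⌉ ⌈ suc b / n ⌉) (⌈m/n⌉+⌈1+o/n⌉≤⌈[m+o]/n⌉+1 a b n)

f′-attains : ∀ m n .{{_ : NonZero n}} → 0 < m →
  Σ[ b ∈ ℕ ] (b ≤ m × f′ n (m ∸ b) b ≡ ⌈ m / n ⌉ + 1)
f′-attains m n 0<m with ⌈ m / n ⌉ in ⌈m/n⌉≡ | 0<m⇒0<⌈m/n⌉ m n 0<m
... | suc c | _ = p * n , <⇒≤ p*n<m , (begin
  2 * ⌈ (m ∸ p * n) / n ⌉ ⊓ (2 * ⌈ suc (p * n) / n ⌉ + 1)
    ≡⟨ cong₂ (λ A B → 2 * A ⊓ (2 * B + 1)) ⌈[m∸p*n]/n⌉≡ ⌈[1+p*n]/n⌉≡ ⟩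
  2 * ⌈ suc (suc c) /2⌉ ⊓ (2 * ⌊ suc (suc c) /2⌋ + 1)
    ≡⟨ 2⌈n/2⌉⊓[2⌊n/2⌋+1]≡n (suc (suc c)) ⟩
  suc (suc c)
    ≡⟨ +-comm 1 (suc c) ⟩
  suc c + 1 ∎)
  where
  open ≡-Reasoning
  p : ℕ
  p = ⌊ c /2⌋
  p*n<m : p * n < m
  p*n<m = m<⌈n/o⌉⇒m*o<n (subst (p <_) (sym ⌈m/n⌉≡) (s≤s (⌊n/2⌋≤n c)))
  ⌈[m∸p*n]/n⌉≡ : ⌈ (m ∸ p * n) / n ⌉ ≡ suc ⌈ c /2⌉
  ⌈[m∸p*n]/n⌉≡ = begin
    ⌈ (m ∸ p * n) / n ⌉ ≡⟨ ⌈[m∸n*o]/o⌉≡⌈m/o⌉∸n m p n (<⇒≤ p*n<m) ⟩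
    ⌈ m / n ⌉ ∸ p       ≡⟨ cong (_∸ p) ⌈m/n⌉≡ ⟩
    suc c ∸ p           ≡⟨ +-∸-assoc 1 (⌊n/2⌋≤n c) ⟩
    suc (c ∸ p)         ≡⟨ cong suc (n∸⌊n/2⌋≡⌈n/2⌉ c) ⟩
    suc ⌈ c /2⌉         ∎
  ⌈[1+p*n]/n⌉≡ : ⌈ suc (p * n) / n ⌉ ≡ suc p
  ⌈[1+p*n]/n⌉≡ = trans (⌈1+m/n⌉≡1+m/n (p * n) n) (cong suc (m*n/n≡m p n))

Δ≡0⇒v≡2k×i≡0 : ∀ {v} k {i} → v ≥ 2 * k → Δ v k i ≡ 0 → v ≡ 2 * k × i ≡ 0
Δ≡0⇒v≡2k×i≡0 {v} k {i} v≥2k Δ≡0 =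
  ≤-antisym (m∸n≡0⇒m≤n (m+n≡0⇒m≡0 (v ∸ 2 * k) Δ≡0)) v≥2k ,
  m*n≡0⇒m≡0 i 2 (trans (*-comm i 2) (m+n≡0⇒n≡0 (v ∸ 2 * k) Δ≡0))

f≤⌈[k∸[1+i]]/Δ⌉+1 : ∀ v k i .{{_ : NonZero (Δ v k i)}} x → i < x → x ≤ k →
  f v k i x ≤ ⌈ (k ∸ suc i) / Δ v k i ⌉ + 1
f≤⌈[k∸[1+i]]/Δ⌉+1 v k i x i<x x≤k = begin
  f v k i x                                   ≡⟨ f≡f′ v k i<x ⟩
  f′ (Δ v k i) (k ∸ x) (x ∸ suc i)            ≤⟨ f′≤⌈[a+b]/n⌉+1 (k ∸ x) (x ∸ suc i) (Δ v k i) ⟩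
  ⌈ (k ∸ x + (x ∸ suc i)) / Δ v k i ⌉ + 1     ≡⟨ cong (λ l → ⌈ l / Δ v k i ⌉ + 1) (m∸n+[n∸o]≡m∸o i<x x≤k) ⟩
  ⌈ (k ∸ suc i) / Δ v k i ⌉ + 1               ∎
  where open ≤-Reasoning

f-attains : ∀ v k i .{{_ : NonZero (Δ v k i)}} → suc i < k →
  Σ[ x ∈ ℕ ] (i < x × x ≤ k × f v k i x ≡ ⌈ (k ∸ suc i) / Δ v k i ⌉ + 1)
f-attains v k i 1+i<k with f′-attains (k ∸ suc i) (Δ v k i) (m<n⇒0<n∸m 1+i<k)
... | b , b≤k∸[1+i] , f′≡ = suc i + b , i<x , x≤k , (begin
  f v k i (suc i + b)                                 ≡⟨ f≡f′ v k i<x ⟩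
  f′ (Δ v k i) (k ∸ (suc i + b)) (suc i + b ∸ suc i)
    ≡⟨ cong₂ (f′ (Δ v k i)) (sym (∸-+-assoc k (suc i) b)) (m+n∸m≡n (suc i) b) ⟩
  f′ (Δ v k i) (k ∸ suc i ∸ b) b                      ≡⟨ f′≡ ⟩
  ⌈ (k ∸ suc i) / Δ v k i ⌉ + 1                       ∎)
  where
  open ≡-Reasoning
  i<x : i < suc i + b
  i<x = s≤s (m≤m+n i b)
  x≤k : suc i + b ≤ k
  x≤k = subst (suc i + b ≤_) (m+[n∸m]≡n (<⇒≤ 1+i<k)) (+-monoʳ-≤ (suc i) b≤k∸[1+i])

lemma4p2 : (v k i : ℕ) → k < v → i < k → v ≥ 2 * k → ¬ (v ≡ 2 * k × i ≡ 0) → i + 1 < k →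
    ((x : ℕ) → i < x → x ≤ k → f v k i x ≤ ⌈ (k ∸ i ∸ 1) / Δ v k i ⌉ + 1)
    × (Σ[ x ∈ ℕ ] (i < x × x ≤ k × f v k i x ≡ ⌈ (k ∸ i ∸ 1) / Δ v k i ⌉ + 1))
lemma4p2 v k i _ _ v≥2k ¬v≡2k×i≡0 i+1<k rewrite ∸-+-assoc k i 1 | +-comm i 1 =
  f≤⌈[k∸[1+i]]/Δ⌉+1 v k i , f-attains v k i i+1<k
  where
  instance
    Δ-nonZero : NonZero (Δ v k i)
    Δ-nonZero = ≢-nonZero (λ Δ≡0 → ¬v≡2k×i≡0 (Δ≡0⇒v≡2k×i≡0 k v≥2k Δ≡0))
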